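{- Let $\ell,\rho$ be positive integers with $\ell\le\rho$, and let $\mathcal C=\{(x,y)\in(\tfrac{\ell}{2}\mathbb Z)^2 : \sqrt{x^2+y^2}\le\rho-\tfrac{\ell}{4}\}$. Then $|\mathcal C|\ge 1+\rho^2/\ell^2$.
   Context: $\tfrac{\ell}{2}\mathbb Z=\{k\ell/2 : k\in\mathbb Z\}$, so $\mathcal C$ is the set of vertices of the square grid of step $\ell/2$ lying in the closed disk of center $(0,0)$ and radius $\rho-\ell/4$. -}

module Defs where

open import Data.Nat using (ℕ; suc; _+_; _*_; _∸_; _≤_; _≤?_)
open import Data.Integer as ℤ using (ℤ; +_; ∣_∣)
open import Data.List using (List; map; upTo; length; filter; cartesianProduct)
open import Data.Product using (_×_; _,_)
open import Relation.Nullary using (Dec)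

ints : ℕ → List ℤ
ints R = map (λ i → (+ i) ℤ.- (+ R)) (upTo (suc (2 * R)))

-- A point (x , y) = (k ℓ/2 , m ℓ/2) of (ℓ/2 ℤ)² is encoded by (k , m) ∈ ℤ².
-- sqrt(x²+y²) ≤ ρ - ℓ/4  (with ρ - ℓ/4 ≥ 0 since ℓ ≤ ρ) is equivalent, after
-- squaring and multiplying by 16, to  4 ℓ² (k² + m²) ≤ (4ρ - ℓ)².
InC : ℕ → ℕ → ℤ × ℤ → Set
InC ℓ ρ (k , m) = 4 * (ℓ * ℓ) * (∣ k ∣ * ∣ k ∣ + ∣ m ∣ * ∣ m ∣) ≤ (4 * ρ ∸ ℓ) * (4 * ρ ∸ ℓ)

inC? : ∀ ℓ ρ p → Dec (InC ℓ ρ p)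
inC? ℓ ρ (k , m) = _ ≤? _

-- |C|: every point of C has |k|ℓ/2 ≤ ρ, hence |k|,|m| ≤ 2ρ (ℓ ≥ 1), so
-- C is enumerated exactly (without repetition) by filtering the box [-2ρ,2ρ]².
cardC : ℕ → ℕ → ℕ
cardC ℓ ρ = length (filter (inC? ℓ ρ) (cartesianProduct (ints (2 * ρ)) (ints (2 * ρ))))

{-# OPTIONS --safe #-}
-- With q = ⌊ρ/ℓ⌋ ≥ 1, every pair (k , m) with |k|, |m| ≤ q encodes a point of C, since
-- 4ℓ²(k² + m²) ≤ 8(qℓ)² ≤ 9ρ² ≤ (4ρ − ℓ)². These (2q+1)² pairs form a sublist of the
-- enumerated box [−2ρ, 2ρ]², so |C| ≥ (2q+1)²; and ρ < (q+1)ℓ gives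
-- ℓ² + ρ² ≤ ℓ²(1 + (q+1)²) ≤ ℓ²(2q+1)².
module Submission where

open import Defs
open import Data.Nat using (ℕ; NonZero; >-nonZero; zero; suc; _+_; _*_; _∸_; _≤_; _<_; _≤′_; ≤′-refl; ≤′-step; z≤n)
open import Data.Nat.Properties
open import Data.Nat.DivMod using (_/_; m≡m%n+[m/n]*n; m%n<n; m/n*n≤m; m≥n⇒m/n>0)
open import Data.Nat.Tactic.RingSolver using (solve)
open import Data.Integer as ℤ using (ℤ; +_; -[1+_]; ∣_∣; _⊖_)
open import Data.Integer.Properties using ([+m]-[+n]≡m⊖n; [1+m]⊖[1+n]≡m⊖n; ⊖-≥)
import Data.List as List
open import Data.List using (List; []; _∷_; [_]; _++_; map; upTo; applyUpTo; length; filter; cartesianProduct)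
open import Data.List.Properties using (length-map; length-upTo; length-++; filter-all; map-upTo; map-cong; applyUpTo-∷ʳ)
open import Data.List.Relation.Unary.All as All using (All; []; _∷_)
import Data.List.Relation.Unary.All.Properties as All
open import Data.List.Relation.Binary.Sublist.Propositional using (_⊆_; []; _∷_; _∷ʳ_; ⊆-refl; ⊆-trans; minimum)
open import Data.List.Relation.Binary.Sublist.Propositional.Properties using (filter⁺; map⁺; ++⁺; ++⁺ˡ; ++⁺ʳ)
open import Data.List.Relation.Binary.Sublist.Heterogeneous.Properties using (length-mono-≤)
open import Data.Product using (_×_; _,_)
open import Relation.Unary using (Pred; Decidable)
open import Relation.Binary.PropositionalEquality
  using (_≡_; refl; sym; trans; subst; cong; cong₂; setoid; module ≡-Reasoning)
open import Function using (_∘′_)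

module _ {a p} {A : Set a} {P : Pred A p} (P? : Decidable P) where

  length≤length-filter : ∀ {xs ys} → All P xs → xs ⊆ ys → length xs ≤ length (filter P? ys)
  length≤length-filter {xs} {ys} pxs xs⊆ys = begin
    length xs              ≡⟨ cong length (filter-all P? pxs) ⟨
    length (filter P? xs)  ≤⟨ length-mono-≤ (filter⁺ P? P? (λ { refl px → px }) xs⊆ys) ⟩
    length (filter P? ys)  ∎
    where open ≤-Reasoning

module _ {a b} {A : Set a} {B : Set b} where

  cartesianProduct⁺ : {xs xs′ : List A} {ys ys′ : List B} →
    xs ⊆ xs′ → ys ⊆ ys′ → cartesianProduct xs ys ⊆ cartesianProduct xs′ ys′
  cartesianProduct⁺ []                          ys⊆ys′ = minimum _
  cartesianProduct⁺ {ys′ = ys′} (x ∷ʳ xs⊆xs′) ys⊆ys′ =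
    ++⁺ˡ (map (x ,_) ys′) (cartesianProduct⁺ xs⊆xs′ ys⊆ys′)
  cartesianProduct⁺ (refl ∷ xs⊆xs′)             ys⊆ys′ =
    ++⁺ (map⁺ _ ys⊆ys′) (cartesianProduct⁺ xs⊆xs′ ys⊆ys′)

  length-cartesianProduct : (xs : List A) (ys : List B) →
    length (cartesianProduct xs ys) ≡ length xs * length ys
  length-cartesianProduct []       ys = refl
  length-cartesianProduct (x ∷ xs) ys = begin
    length (map (x ,_) ys ++ cartesianProduct xs ys)
      ≡⟨ length-++ (map (x ,_) ys) ⟩
    length (map (x ,_) ys) + length (cartesianProduct xs ys)
      ≡⟨ cong₂ _+_ (length-map (x ,_) ys) (length-cartesianProduct xs ys) ⟩
    length ys + length xs * length ys
      ∎
    where open ≡-Reasoning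

m<[1+m/n]*n : ∀ m n .{{_ : NonZero n}} → m < suc (m / n) * n
m<[1+m/n]*n m n =
  subst (_< suc (m / n) * n) (sym (m≡m%n+[m/n]*n m n)) (+-monoˡ-< (m / n * n) (m%n<n m n))

3m≤4m∸n : ∀ {m n} → n ≤ m → 3 * m ≤ 4 * m ∸ n
3m≤4m∸n {m} {n} n≤m = m+n≤o⇒m≤o∸n (3 * m) (begin
  3 * m + n  ≤⟨ +-monoʳ-≤ (3 * m) n≤m ⟩
  3 * m + m  ≡⟨ +-comm (3 * m) m ⟩
  4 * m      ∎)
  where open ≤-Reasoning

1+[1+q]²≤[1+2q]² : ∀ {q} → 1 ≤ q → 1 + suc q * suc q ≤ suc (2 * q) * suc (2 * q)
1+[1+q]²≤[1+2q]² {suc d} _ = begin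
  1 + suc (suc d) * suc (suc d)                              ≤⟨ m≤m+n _ (4 + 8 * d + 3 * (d * d)) ⟩
  1 + suc (suc d) * suc (suc d) + (4 + 8 * d + 3 * (d * d))  ≡⟨ solve (d List.∷ List.[]) ⟩
  suc (2 * suc d) * suc (2 * suc d)                          ∎
  where open ≤-Reasoning

[+1+m]-[+1+n]≡[+m]-[+n] : ∀ m n → + suc m ℤ.- + suc n ≡ + m ℤ.- + n
[+1+m]-[+1+n]≡[+m]-[+n] m n = begin
  + suc m ℤ.- + suc n  ≡⟨ [+m]-[+n]≡m⊖n (suc m) (suc n) ⟩
  suc m ⊖ suc n        ≡⟨ [1+m]⊖[1+n]≡m⊖n m n ⟩
  m ⊖ n                ≡⟨ [+m]-[+n]≡m⊖n m n ⟨
  + m ℤ.- + n          ∎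
  where open ≡-Reasoning

m+m⊖m≡m : ∀ m → (m + m) ⊖ m ≡ + m
m+m⊖m≡m m = trans (⊖-≥ (m≤n+m m m)) (cong +_ (m+n∸n≡m m m))

length-ints : ∀ R → length (ints R) ≡ suc (2 * R)
length-ints R = trans (length-map _ (upTo (suc (2 * R)))) (length-upTo (suc (2 * R)))

ints-suc : ∀ R → ints (suc R) ≡ -[1+ R ] ∷ ints R ++ [ + suc R ]
ints-suc R = begin
  ints (suc R)                                   ≡⟨ map-upTo f (suc (2 * suc R)) ⟩
  applyUpTo f (suc (2 * suc R))                  ≡⟨ cong (applyUpTo f ∘′ suc) (*-suc 2 R) ⟩
  f 0 ∷ applyUpTo (f ∘′ suc) (suc n)             ≡⟨ cong (f 0 ∷_) (applyUpTo-∷ʳ (f ∘′ suc) n) ⟨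
  f 0 ∷ applyUpTo (f ∘′ suc) n ++ [ f (suc n) ]  ≡⟨ cong₂ (λ xs x → f 0 ∷ xs ++ [ x ]) shifted last ⟩
  -[1+ R ] ∷ ints R ++ [ + suc R ]               ∎
  where
  open ≡-Reasoning
  f : ℕ → ℤ
  f i = + i ℤ.- + suc R
  n : ℕ
  n = suc (2 * R)
  shifted : applyUpTo (f ∘′ suc) n ≡ ints R
  shifted = begin
    applyUpTo (f ∘′ suc) n   ≡⟨ map-upTo (f ∘′ suc) n ⟨
    map (f ∘′ suc) (upTo n)  ≡⟨ map-cong (λ i → [+1+m]-[+1+n]≡[+m]-[+n] i R) (upTo n) ⟩
    ints R                   ∎
  2+2R≡[1+R]+[1+R] : suc (suc (2 * R)) ≡ suc R + suc R
  2+2R≡[1+R]+[1+R] = solve (R List.∷ List.[])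
  last : f (suc n) ≡ + suc R
  last = begin
    f (suc n)                ≡⟨ [+m]-[+n]≡m⊖n (suc n) (suc R) ⟩
    suc n ⊖ suc R            ≡⟨ cong (_⊖ suc R) 2+2R≡[1+R]+[1+R] ⟩
    (suc R + suc R) ⊖ suc R  ≡⟨ m+m⊖m≡m (suc R) ⟩
    + suc R                  ∎

ints-⊆-suc : ∀ R → ints R ⊆ ints (suc R)
ints-⊆-suc R rewrite ints-suc R = -[1+ R ] ∷ʳ ++⁺ʳ [ + suc R ] ⊆-refl

ints-⊆ : ∀ {q R} → q ≤′ R → ints q ⊆ ints R
ints-⊆ ≤′-refl        = ⊆-refl
ints-⊆ (≤′-step q≤′R) = ⊆-trans (ints-⊆ q≤′R) (ints-⊆-suc _)

ints-bounded : ∀ R → All (λ k → ∣ k ∣ ≤ R) (ints R)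
ints-bounded zero    = z≤n ∷ []
ints-bounded (suc R) rewrite ints-suc R =
  ≤-refl ∷ All.++⁺ (All.map m≤n⇒m≤1+n (ints-bounded R)) (≤-refl ∷ [])

square : ℕ → List (ℤ × ℤ)
square R = cartesianProduct (ints R) (ints R)

length-square : ∀ R → length (square R) ≡ suc (2 * R) * suc (2 * R)
length-square R =
  trans (length-cartesianProduct (ints R) (ints R)) (cong₂ _*_ (length-ints R) (length-ints R))

square-⊆ : ∀ {q R} → q ≤ R → square q ⊆ square R
square-⊆ q≤R = cartesianProduct⁺ (ints-⊆ (≤⇒≤′ q≤R)) (ints-⊆ (≤⇒≤′ q≤R))

square-bounded : ∀ R → All (λ (k , m) → ∣ k ∣ ≤ R × ∣ m ∣ ≤ R) (square R)
square-bounded R = All.cartesianProduct⁺ (setoid ℤ) (setoid ℤ) (ints R) (ints R)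
  (λ k∈ m∈ → All.lookup (ints-bounded R) k∈ , All.lookup (ints-bounded R) m∈)

InC-bounded : ∀ {ℓ ρ q} → q * ℓ ≤ ρ → ℓ ≤ ρ → ∀ k m → ∣ k ∣ ≤ q → ∣ m ∣ ≤ q → InC ℓ ρ (k , m)
InC-bounded {ℓ} {ρ} {q} qℓ≤ρ ℓ≤ρ k m ∣k∣≤q ∣m∣≤q = begin
  4 * (ℓ * ℓ) * (∣ k ∣ * ∣ k ∣ + ∣ m ∣ * ∣ m ∣)
    ≤⟨ *-monoʳ-≤ (4 * (ℓ * ℓ)) (+-mono-≤ (*-mono-≤ ∣k∣≤q ∣k∣≤q) (*-mono-≤ ∣m∣≤q ∣m∣≤q)) ⟩
  4 * (ℓ * ℓ) * (q * q + q * q)  ≡⟨ solve (ℓ List.∷ q List.∷ List.[]) ⟩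
  8 * (q * ℓ * (q * ℓ))          ≤⟨ *-monoʳ-≤ 8 (*-mono-≤ qℓ≤ρ qℓ≤ρ) ⟩
  8 * (ρ * ρ)                    ≤⟨ *-monoˡ-≤ (ρ * ρ) (n≤1+n 8) ⟩
  9 * (ρ * ρ)                    ≡⟨ solve (ρ List.∷ List.[]) ⟩
  3 * ρ * (3 * ρ)                ≤⟨ *-mono-≤ (3m≤4m∸n ℓ≤ρ) (3m≤4m∸n ℓ≤ρ) ⟩
  (4 * ρ ∸ ℓ) * (4 * ρ ∸ ℓ)      ∎
  where open ≤-Reasoning

[1+2q]²≤cardC : ∀ {ℓ ρ q} .{{_ : NonZero ℓ}} → q * ℓ ≤ ρ → ℓ ≤ ρ →
  suc (2 * q) * suc (2 * q) ≤ cardC ℓ ρ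
[1+2q]²≤cardC {ℓ} {ρ} {q} qℓ≤ρ ℓ≤ρ = begin
  suc (2 * q) * suc (2 * q)  ≡⟨ length-square q ⟨
  length (square q)          ≤⟨ length≤length-filter (inC? ℓ ρ) square-in-C (square-⊆ q≤2ρ) ⟩
  cardC ℓ ρ                  ∎
  where
  open ≤-Reasoning
  square-in-C : All (InC ℓ ρ) (square q)
  square-in-C = All.map (λ { {k , m} (∣k∣≤q , ∣m∣≤q) → InC-bounded qℓ≤ρ ℓ≤ρ k m ∣k∣≤q ∣m∣≤q })
                        (square-bounded q)
  q≤2ρ : q ≤ 2 * ρ
  q≤2ρ = ≤-trans (m≤m*n q ℓ) (≤-trans qℓ≤ρ (m≤m+n ρ (ρ + 0)))

ℓ²+ρ²≤ℓ²[1+2q]² : ∀ {ℓ ρ q} → ρ ≤ suc q * ℓ → 1 ≤ q →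
  ℓ * ℓ + ρ * ρ ≤ ℓ * ℓ * (suc (2 * q) * suc (2 * q))
ℓ²+ρ²≤ℓ²[1+2q]² {ℓ} {ρ} {q} ρ≤[1+q]ℓ 1≤q = begin
  ℓ * ℓ + ρ * ρ                        ≤⟨ +-monoʳ-≤ (ℓ * ℓ) (*-mono-≤ ρ≤[1+q]ℓ ρ≤[1+q]ℓ) ⟩
  ℓ * ℓ + suc q * ℓ * (suc q * ℓ)      ≡⟨ solve (ℓ List.∷ q List.∷ List.[]) ⟩
  ℓ * ℓ * (1 + suc q * suc q)          ≤⟨ *-monoʳ-≤ (ℓ * ℓ) (1+[1+q]²≤[1+2q]² 1≤q) ⟩
  ℓ * ℓ * (suc (2 * q) * suc (2 * q))  ∎
  where open ≤-Reasoning

lemma12 : (ℓ ρ : ℕ) → 0 < ℓ → 0 < ρ → ℓ ≤ ρ →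
    ℓ * ℓ + ρ * ρ ≤ ℓ * ℓ * cardC ℓ ρ
lemma12 ℓ ρ 0<ℓ _ ℓ≤ρ = begin
  ℓ * ℓ + ρ * ρ                        ≤⟨ ℓ²+ρ²≤ℓ²[1+2q]² (<⇒≤ (m<[1+m/n]*n ρ ℓ)) (m≥n⇒m/n>0 ℓ≤ρ) ⟩
  ℓ * ℓ * (suc (2 * q) * suc (2 * q))  ≤⟨ *-monoʳ-≤ (ℓ * ℓ) ([1+2q]²≤cardC {q = q} (m/n*n≤m ρ ℓ) ℓ≤ρ) ⟩
  ℓ * ℓ * cardC ℓ ρ                    ∎
  where
  open ≤-Reasoning
  instance _ = >-nonZero 0<ℓ
  q : ℕ
  q = ρ / ℓ
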